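{- Let $G$ be a graph, $r\in V(G)$, and $t\ge 2$. Suppose $\{S_i\}_{i\in[t]}$ is a nice collection of trees in $G$ rooted at $r$ (as defined in the context). Then $G$ contains independent spanning trees $T_1,\dots,T_t$ rooted at $r$ such that $S_i\subseteq T_i$ for each $i\in[t]$.
   Context: Let $\{S_i\}_{i\in[t]}$ be a collection of subtrees of $G$, each containing (and rooted at) the same vertex $r$, and pairwise vertex-disjoint apart from $r$. For $v\in V(G)$ let $I(v)=\{i\in[t]: v\notin S_i\cup N(S_i)\}$, where $N(S_i)$ is the set of vertices outside $S_i$ adjacent to some vertex of $S_i$. The collection is nice if for every $v\in V(G)$ one can choose, for each $i\in I(v)$, vertices $u_i\notin\bigcup_{j\in[t]}V(S_j)$ and $w_i\in V(S_i)$ such that the $u_i$ ($i\in I(v)$) are pairwise distinct and $v u_i w_i$ is a path with two edges in $G$. Spanning trees $T_1,\dots,T_t$ of $G$ rooted at $r$ are independent if for every $v\in V(G)$ the unique $r$–$v$ paths in $T_1,\dots,T_t$ are pairwise internally vertex-disjoint. -}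

module Defs where

open import Data.Nat using (ℕ; _≤_; _≥_)
open import Data.Fin using (Fin)
open import Data.Bool using (Bool; true; false; T)
open import Data.List using (List; []; _∷_; length)
open import Data.List.Relation.Unary.Unique.Propositional using (Unique)
open import Data.List.Membership.Propositional using (_∈_)
open import Data.Product using (Σ; ∃; ∃-syntax; _×_; _,_)
open import Data.Sum using (_⊎_)
open import Relation.Nullary using (¬_)
open import Relation.Binary.PropositionalEquality using (_≡_; _≢_)

record Graph : Set where
  field
    n     : ℕ
    adj   : Fin n → Fin n → Bool
    sym   : ∀ u v → adj u v ≡ adj v u
    irrefl : ∀ v → adj v v ≡ false
open Graph public

record Subgraph (G : Graph) : Set where
  field
    vs    : Fin (n G) → Bool
    es    : Fin (n G) → Fin (n G) → Bool
    es-sym : ∀ u v → es u v ≡ es v u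
    es-ok : ∀ u v → T (es u v) → T (adj G u v) × T (vs u) × T (vs v)
open Subgraph public

module _ {G : Graph} (H : Subgraph G) where

  data Walk : Fin (n G) → Fin (n G) → List (Fin (n G)) → Set where
    here : ∀ {v} → T (vs H v) → Walk v v (v ∷ [])
    step : ∀ {u w v ps} → T (es H u w) → Walk w v ps → Walk u v (u ∷ ps)

  Path : Fin (n G) → Fin (n G) → List (Fin (n G)) → Set
  Path u v ps = Walk u v ps × Unique ps

  HasCycle : Set
  HasCycle = ∃[ u ] ∃[ w ] ∃[ ps ] (Path u w ps × 3 ≤ length ps × T (es H w u))

  Connected : Set
  Connected = ∀ u v → T (vs H u) → T (vs H v) → ∃[ ps ] Path u v ps

  IsTree : Set
  IsTree = (∃[ v ] T (vs H v)) × Connected × ¬ HasCycle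

  Spanning : Set
  Spanning = ∀ v → T (vs H v)

_⊆ᴳ_ : {G : Graph} → Subgraph G → Subgraph G → Set
_⊆ᴳ_ {G} S T′ = (∀ v → T (vs S v) → T (vs T′ v))
              × (∀ u v → T (es S u v) → T (es T′ u v))

InNbhd : {G : Graph} → Subgraph G → Fin (n G) → Set
InNbhd {G} S v = ¬ T (vs S v) × ∃[ x ] (T (vs S x) × T (adj G x v))

InI : {G : Graph} {t : ℕ} → (Fin t → Subgraph G) → Fin (n G) → Fin t → Set
InI S v i = ¬ (T (vs (S i) v) ⊎ InNbhd (S i) v)

IsTreeCollection : (G : Graph) (r : Fin (n G)) (t : ℕ) → (Fin t → Subgraph G) → Set
IsTreeCollection G r t S =
    (∀ i → IsTree (S i))
  × (∀ i → T (vs (S i) r))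
  × (∀ i j x → i ≢ j → T (vs (S i) x) → T (vs (S j) x) → x ≡ r)

Nice : (G : Graph) (t : ℕ) → (Fin t → Subgraph G) → Set
Nice G t S = ∀ (v : Fin (n G)) →
  Σ (Fin t → Fin (n G)) λ u → Σ (Fin t → Fin (n G)) λ w → (
      (∀ i → InI S v i →
          (∀ j → ¬ T (vs (S j) (u i)))
        × T (vs (S i) (w i))
        × T (adj G v (u i))
        × T (adj G (u i) (w i)))
    × (∀ i j → InI S v i → InI S v j → i ≢ j → u i ≢ u j))

Independent : (G : Graph) (r : Fin (n G)) (t : ℕ) → (Fin t → Subgraph G) → Set
Independent G r t Ts = ∀ (v : Fin (n G)) (i j : Fin t) → i ≢ j →
  ∀ P Q → Path (Ts i) r v P → Path (Ts j) r v Q →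
  ∀ x → x ∈ P → x ∈ Q → (x ≡ r) ⊎ (x ≡ v)

{-# OPTIONS --safe #-}
module Submission where

-- T_i consists of S_i plus one edge from each vertex v ∉ S_i to a parent: a neighbour in
-- S_i when v ∈ N(S_i), and otherwise u_i(v), which lies in N(S_i).  Parents strictly
-- lower the rank (0 on S_i, 1 on N(S_i), 2 elsewhere), so T_i is a spanning tree in which
-- a path starting in S_i can leave S_i only by descending from parents to children.  Hence
-- the r–v path of T_i meets V ∖ S_i only in v and, when i ∈ I(v), in u_i(v).  Since the
-- S_i meet only in r, while niceness puts every u_i(v) outside all S_j and makes them
-- distinct, two such paths share only r and v.

open import Defs
open import Data.Nat using (ℕ; _≥_; zero; suc; _≤_; _<_; s≤s; s≤s⁻¹)
open import Data.Nat.Properties using (≤-refl; ≤-trans; ≤-reflexive; <⇒≤; <-irrefl; <-trans; ≤-<-trans; <-≤-trans; n≮0)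
open import Data.Fin using (Fin)
open import Data.Fin.Properties using (_≟_; any?)
open import Data.Product using (∃; ∃-syntax; _×_; _,_; proj₁; proj₂; uncurry)
open import Data.Sum using (_⊎_; inj₁; inj₂; [_,_]′)
open import Data.Bool using (Bool; true; T; _∨_)
open import Data.Bool.Properties using (T-∨; ∨-comm)
open import Data.Unit using (tt)
open import Data.Empty using (⊥; ⊥-elim)
open import Data.List using (List; _∷_)
open import Data.List.Membership.Propositional using (_∈_; _∉_)
open import Data.List.Relation.Unary.Any using (here; there)
open import Data.List.Relation.Unary.All as All using (All; lookup; []; _∷_)
open import Data.List.Relation.Unary.All.Properties using (¬Any⇒All¬)
open import Data.List.Relation.Unary.Unique.Propositional using (Unique)
open import Data.List.Relation.Unary.Unique.Propositional.Properties using (Unique[x∷xs]⇒x∉xs)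
open import Data.List.Relation.Unary.AllPairs using ([]; _∷_)
open import Relation.Nullary using (¬_; Dec; yes; no; ¬?; T?)
open import Relation.Nullary.Decidable using (toWitness; fromWitness; _×-dec_; isYes)
open import Relation.Binary.PropositionalEquality using (_≡_; _≢_; refl; trans; cong₂; subst) renaming (sym to ≡-sym)
open import Function.Bundles using (Equivalence)
open Equivalence using (to; from)

module _ {G : Graph} where

  private
    variable
      H H′ : Subgraph G
      a b c : Fin (n G)
      ps qs : List (Fin (n G))

  open import Data.List.Membership.DecPropositional (_≟_ {n G}) using (_∈?_)

  head∈ : Walk H a b ps → a ∈ ps
  head∈ (here _)   = here refl
  head∈ (step _ _) = here refl

  last∈ : Walk H a b ps → b ∈ ps
  last∈ (here _)   = here refl
  last∈ (step _ w) = there (last∈ w)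

  walk-mono : H ⊆ᴳ H′ → Walk H a b ps → Walk H′ a b ps
  walk-mono (vs⊆ , _)   (here a∈H) = here (vs⊆ _ a∈H)
  walk-mono H⊆@(_ , es⊆) (step e w) = step (es⊆ _ _ e) (walk-mono H⊆ w)

  walk-snoc : Walk H a b ps → T (es H b c) → ∃ (Walk H a c)
  walk-snoc {H = H} (here _) e = _ , step e (here (proj₂ (proj₂ (es-ok H _ _ e))))
  walk-snoc (step e′ w) e = _ , step e′ (proj₂ (walk-snoc w e))

  walk-reverse : Walk H a b ps → ∃ (Walk H b a)
  walk-reverse (here a∈H) = _ , here a∈H
  walk-reverse {H = H} (step {u} {w} e wk) =
    walk-snoc (proj₂ (walk-reverse wk)) (subst T (es-sym H u w) e)

  walk-++ : Walk H a b ps → Walk H b c qs → ∃ (Walk H a c)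
  walk-++ (here _)   w′ = _ , w′
  walk-++ (step e w) w′ = _ , step e (proj₂ (walk-++ w w′))

  path-from-∈ : Walk H c b qs → Unique qs → a ∈ qs → ∃ (Path H a b)
  path-from-∈ w@(here _)   u       (here refl) = _ , w , u
  path-from-∈ w@(step _ _) u       (here refl) = _ , w , u
  path-from-∈ (step _ w)   (_ ∷ u) (there a∈)  = path-from-∈ w u a∈

  walk⇒path : Walk H a b ps → ∃ (Path H a b)
  walk⇒path (here a∈H) = _ , here a∈H , [] ∷ []
  walk⇒path {a = a} (step e w) with walk⇒path w
  ... | qs , p , u with a ∈? qs
  ...   | yes a∈qs = path-from-∈ p u a∈qs
  ...   | no  a∉qs = _ , step e p , ¬Any⇒All¬ qs a∉qs ∷ u

  walks-to⇒connected : (r : Fin (n G)) → (∀ x → ∃ (Walk H x r)) → Connected H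
  walks-to⇒connected r to-r u v _ _ =
    walk⇒path (proj₂ (walk-++ (proj₂ (to-r u)) (proj₂ (walk-reverse (proj₂ (to-r v))))))

module ParentExtension {G : Graph} (S : Subgraph G)
  (parent : Fin (n G) → Fin (n G)) (rank : Fin (n G) → ℕ)
  (parent-adj  : ∀ v → ¬ T (vs S v) → T (adj G v (parent v)))
  (rank-S      : ∀ v → T (vs S v) → rank v ≡ 0)
  (rank-parent : ∀ v → ¬ T (vs S v) → rank (parent v) < rank v)
  where

  private
    V = Fin (n G)
    variable
      a b c u v w x : V
      P Q : List V

  InS : V → Set
  InS v = T (vs S v)

  ParentEdge : V → V → Set
  ParentEdge a b = ¬ InS a × parent a ≡ b

  parentEdge? : ∀ a b → Dec (ParentEdge a b)
  parentEdge? a b = ¬? (T? (vs S a)) ×-dec (parent a ≟ b)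

  tree-edge-inˡ : T (es S a b) → InS a
  tree-edge-inˡ s = proj₁ (proj₂ (es-ok S _ _ s))

  tree-edge-inʳ : T (es S a b) → InS b
  tree-edge-inʳ s = proj₂ (proj₂ (es-ok S _ _ s))

  extension-edge : V → V → Bool
  extension-edge a b = es S a b ∨ (isYes (parentEdge? a b) ∨ isYes (parentEdge? b a))

  data EdgeView (a b : V) : Set where
    tree-edge : T (es S a b) → EdgeView a b
    to-parent : ¬ InS a → parent a ≡ b → EdgeView a b
    to-child  : ¬ InS b → parent b ≡ a → EdgeView a b

  edge-view : T (extension-edge a b) → EdgeView a b
  edge-view {a} {b} e with to T-∨ e
  ... | inj₁ s = tree-edge s
  ... | inj₂ e′ with to (T-∨ {isYes (parentEdge? a b)}) e′
  ...   | inj₁ ab = uncurry to-parent (toWitness {a? = parentEdge? a b} ab)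
  ...   | inj₂ ba = uncurry to-child (toWitness {a? = parentEdge? b a} ba)

  edge-adj : T (extension-edge a b) → T (adj G a b)
  edge-adj e with edge-view e
  ... | tree-edge s        = proj₁ (es-ok S _ _ s)
  ... | to-parent a∉S refl = parent-adj _ a∉S
  ... | to-child  b∉S refl = subst T (Graph.sym G _ _) (parent-adj _ b∉S)

  extension : Subgraph G
  extension = record
    { vs     = λ _ → true
    ; es     = extension-edge
    ; es-sym = λ a b → cong₂ _∨_ (es-sym S a b) (∨-comm (isYes (parentEdge? a b)) _)
    ; es-ok  = λ a b e → edge-adj e , tt , tt
    }

  S⊆extension : S ⊆ᴳ extension
  S⊆extension = (λ _ _ → tt) , (λ _ _ s → from T-∨ (inj₁ s))

  edge-to-parent : ¬ InS v → T (extension-edge v (parent v))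
  edge-to-parent {v} v∉S =
    from (T-∨ {es S v (parent v)})
         (inj₂ (from T-∨ (inj₁ (fromWitness {a? = parentEdge? v (parent v)} (v∉S , refl)))))

  data _↝_ : V → V → Set where
    done : v ↝ v
    up   : ¬ InS v → parent v ↝ x → v ↝ x

  ↝-snoc : v ↝ x → ¬ InS x → v ↝ parent x
  ↝-snoc done          x∉S = up x∉S done
  ↝-snoc (up v∉S v↝x) x∉S = up v∉S (↝-snoc v↝x x∉S)

  ↝-rank : v ↝ x → rank x ≤ rank v
  ↝-rank done          = ≤-refl
  ↝-rank (up v∉S v↝x) = ≤-trans (↝-rank v↝x) (<⇒≤ (rank-parent _ v∉S))

  ¬↝-from-S : InS v → ¬ InS x → ¬ v ↝ x
  ¬↝-from-S v∈S x∉S done       = x∉S v∈S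
  ¬↝-from-S v∈S _   (up v∉S _) = v∉S v∈S

  -- A vertex outside S has no tree edges, and the path may not return to its parent, so
  -- after stepping down to a child a path keeps descending.
  descending : Walk extension c b Q → ¬ InS c → parent c ∉ Q → Unique Q →
               parent b ∈ parent c ∷ Q × All (b ↝_) Q
  descending (here _) _ _ _ = here refl , done ∷ []
  descending (step e w) c∉S pc∉Q (_ ∷ uQ) with edge-view e
  ... | tree-edge s       = ⊥-elim (c∉S (tree-edge-inˡ s))
  ... | to-parent _ refl  = ⊥-elim (pc∉Q (there (head∈ w)))
  descending (step e w) c∉S pc∉Q uQ@(_ ∷ uQ′) | to-child d∉S refl
    with descending w d∉S (Unique[x∷xs]⇒x∉xs uQ) uQ′
  ... | pb∈ , ancestors = there pb∈ , ↝-snoc (lookup ancestors (head∈ w)) d∉S ∷ ancestors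

  climb : Walk extension a b Q → Unique Q → rank b ≤ rank a ⊎ parent b ∈ Q
  climb (here _) _ = inj₁ ≤-refl
  climb (step e w) uQ@(_ ∷ uQ′) with edge-view e | climb w uQ′
  ... | _ | inj₂ pb∈ = inj₂ (there pb∈)
  ... | tree-edge s | inj₁ rb≤rd =
    inj₁ (≤-trans rb≤rd (≤-reflexive (trans (rank-S _ (tree-edge-inʳ s)) (≡-sym (rank-S _ (tree-edge-inˡ s))))))
  ... | to-parent a∉S refl | inj₁ rb≤rd = inj₁ (≤-trans rb≤rd (<⇒≤ (rank-parent _ a∉S)))
  ... | to-child d∉S refl  | inj₁ _     = inj₂ (proj₁ (descending w d∉S (Unique[x∷xs]⇒x∉xs uQ) uQ′))

  walk-within-S : Walk extension a b Q → Unique Q → InS a → InS b → Walk S a b Q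
  walk-within-S (here _) _ a∈S _ = here a∈S
  walk-within-S (step e w) uQ@(_ ∷ uQ′) a∈S b∈S with edge-view e
  ... | tree-edge s       = step s (walk-within-S w uQ′ (tree-edge-inʳ s) b∈S)
  ... | to-parent a∉S _   = ⊥-elim (a∉S a∈S)
  ... | to-child d∉S refl =
    ⊥-elim (¬↝-from-S b∈S d∉S (lookup (proj₂ (descending w d∉S (Unique[x∷xs]⇒x∉xs uQ) uQ′)) (head∈ w)))

  path-from-S : Walk extension a v Q → Unique Q → InS a → All (λ x → InS x ⊎ v ↝ x) Q
  path-from-S (here _) _ a∈S = inj₁ a∈S ∷ []
  path-from-S (step e w) uQ@(_ ∷ uQ′) a∈S with edge-view e
  ... | tree-edge s       = inj₁ a∈S ∷ path-from-S w uQ′ (tree-edge-inʳ s)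
  ... | to-parent a∉S _   = ⊥-elim (a∉S a∈S)
  ... | to-child d∉S refl =
    inj₁ a∈S ∷ All.map inj₂ (proj₂ (descending w d∉S (Unique[x∷xs]⇒x∉xs uQ) uQ′))

  private
    -- The cycle u x … w u, split according to its two edges at u.
    no-cycle-closing : (Walk S x w P → T (es S u x) → T (es S w u) → ⊥) →
                       Walk extension x w P → Unique P → u ∉ P → x ≢ w →
                       EdgeView u x → EdgeView w u → ⊥
    no-cycle-closing _ P uP u∉P x≢w (to-child x∉S refl) e₂
      with lookup (proj₂ (descending P x∉S u∉P uP)) (head∈ P) | e₂
    ... | w↝x       | tree-edge s       = ¬↝-from-S (tree-edge-inˡ s) x∉S w↝x
    ... | done      | to-parent _ _     = x≢w refl
    ... | up _ pw↝x | to-parent _ pw≡u  =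
      <-irrefl refl (≤-<-trans (↝-rank (subst (_↝ _) pw≡u pw↝x)) (rank-parent _ x∉S))
    ... | w↝x       | to-child u∉S refl =
      <-irrefl refl (<-≤-trans (<-trans (rank-parent _ u∉S) (rank-parent _ x∉S)) (↝-rank w↝x))
    no-cycle-closing in-S P uP u∉P x≢w (tree-edge s₁) (tree-edge s₂) =
      in-S (walk-within-S P uP (tree-edge-inʳ s₁) (tree-edge-inˡ s₂)) s₁ s₂
    no-cycle-closing _ P uP u∉P x≢w (tree-edge s₁) (to-parent w∉S refl) with climb P uP
    ... | inj₁ rw≤rx =
      n≮0 (<-≤-trans (rank-parent _ w∉S) (≤-trans rw≤rx (≤-reflexive (rank-S _ (tree-edge-inʳ s₁)))))
    ... | inj₂ pw∈P = u∉P pw∈P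
    no-cycle-closing _ P uP u∉P x≢w (tree-edge s₁) (to-child u∉S _) = u∉S (tree-edge-inˡ s₁)
    no-cycle-closing _ P uP u∉P x≢w (to-parent u∉S _) (tree-edge s₂) = u∉S (tree-edge-inʳ s₂)
    no-cycle-closing _ P uP u∉P x≢w (to-parent u∉S refl) (to-parent w∉S refl) with climb P uP
    ... | inj₁ rw≤rx = <-irrefl refl (≤-<-trans rw≤rx (<-trans (rank-parent _ u∉S) (rank-parent _ w∉S)))
    ... | inj₂ pw∈P = u∉P pw∈P
    no-cycle-closing _ P uP u∉P x≢w (to-parent _ pu≡x) (to-child _ pu≡w) = x≢w (trans (≡-sym pu≡x) pu≡w)

  extension-acyclic : ¬ HasCycle S → ¬ HasCycle extension
  extension-acyclic _ (_ , _ , _ , (here _ , _) , s≤s () , _)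
  extension-acyclic _ (_ , _ , _ , (step _ (here _) , _) , s≤s (s≤s ()) , _)
  extension-acyclic S-acyclic
    (u , w , _ , (step e₁ P@(step _ P′) , uQ@(u∉P ∷ uP@(x∉P′ ∷ _))) , len , e₂) =
    no-cycle-closing (λ Pˢ s₁ s₂ → S-acyclic (u , w , _ , (step s₁ Pˢ , uQ) , len , s₂))
                     P uP (Unique[x∷xs]⇒x∉xs uQ) (λ x≡w → lookup x∉P′ (last∈ P′) x≡w)
                     (edge-view e₁) (edge-view e₂)

  module _ (s : V) (s∈S : InS s) (S-connected : Connected S) where

    walk-to-root : ∀ k v → rank v ≤ k → ∃ (Walk extension v s)
    walk-to-root k v rv≤k with T? (vs S v)
    ... | yes v∈S = _ , walk-mono S⊆extension (proj₁ (proj₂ (S-connected v s v∈S s∈S)))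
    walk-to-root zero v rv≤0 | no v∉S = ⊥-elim (n≮0 (<-≤-trans (rank-parent v v∉S) rv≤0))
    walk-to-root (suc k) v rv≤k | no v∉S =
      let rpv≤k = s≤s⁻¹ (<-≤-trans (rank-parent v v∉S) rv≤k)
      in  _ , step (edge-to-parent v∉S) (proj₂ (walk-to-root k (parent v) rpv≤k))

  extension-isTree : IsTree S → IsTree extension
  extension-isTree ((s , s∈S) , S-connected , S-acyclic) =
    (s , tt) ,
    walks-to⇒connected s (λ v → walk-to-root s s∈S S-connected (rank v) v ≤-refl) ,
    extension-acyclic S-acyclic

module NiceExtension {G : Graph} {t : ℕ} (S : Fin t → Subgraph G) (nice : Nice G t S) where

  private
    V = Fin (n G)
    variable
      v x : V
      i j : Fin t

  relay : Fin t → V → V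
  relay i v = proj₁ (nice v) i

  anchor : Fin t → V → V
  anchor i v = proj₁ (proj₂ (nice v)) i

  private
    relay-spec : InI S v i →
      (∀ j → ¬ T (vs (S j) (relay i v))) × T (vs (S i) (anchor i v)) ×
      T (adj G v (relay i v)) × T (adj G (relay i v) (anchor i v))
    relay-spec {v} {i} = proj₁ (proj₂ (proj₂ (nice v))) i

  relay-outside : InI S v i → ∀ j → ¬ T (vs (S j) (relay i v))
  relay-outside I = proj₁ (relay-spec I)

  relay-adj : InI S v i → T (adj G v (relay i v))
  relay-adj I = proj₁ (proj₂ (proj₂ (relay-spec I)))

  relay-near : InI S v i → InNbhd (S i) (relay i v)
  relay-near {i = i} I with relay-spec I
  ... | outside , anchor∈S , _ , relay-anchor =
    outside i , _ , anchor∈S , subst T (Graph.sym G _ _) relay-anchor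

  relay-injective : InI S v i → InI S v j → i ≢ j → relay i v ≢ relay j v
  relay-injective {v} {i} {j} = proj₂ (proj₂ (proj₂ (nice v))) i j

  module _ (i : Fin t) where

    InSᵢ : V → Set
    InSᵢ v = T (vs (S i) v)

    data Position (v : V) : Set where
      inside : InSᵢ v → Position v
      near   : InNbhd (S i) v → Position v
      far    : InI S v i → Position v

    position : ∀ v → Position v
    position v with T? (vs (S i) v)
    ... | yes v∈S = inside v∈S
    ... | no  v∉S with any? (λ x → T? (vs (S i) x) ×-dec T? (adj G x v))
    ...   | yes nb = near (v∉S , nb)
    ...   | no ¬nb = far [ v∉S , (λ near → ¬nb (proj₂ near)) ]′

    parentAt : Position v → V
    parentAt {v} (inside _)         = v
    parentAt     (near (_ , x , _)) = x
    parentAt {v} (far _)            = relay i v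

    rankAt : Position v → ℕ
    rankAt (inside _) = 0
    rankAt (near _)   = 1
    rankAt (far _)    = 2

    parentᵢ : V → V
    parentᵢ v = parentAt (position v)

    rankᵢ : V → ℕ
    rankᵢ v = rankAt (position v)

    parentAt-adj : (p : Position v) → ¬ InSᵢ v → T (adj G v (parentAt p))
    parentAt-adj (inside v∈S)             v∉S = ⊥-elim (v∉S v∈S)
    parentAt-adj (near (_ , _ , _ , x-v)) _   = subst T (Graph.sym G _ _) x-v
    parentAt-adj (far I)                  _   = relay-adj I

    rankAt-inside : (p : Position v) → InSᵢ v → rankAt p ≡ 0
    rankAt-inside (inside _)       _   = refl
    rankAt-inside (near (v∉S , _)) v∈S = ⊥-elim (v∉S v∈S)
    rankAt-inside (far I)          v∈S = ⊥-elim (I (inj₁ v∈S))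

    near-position : InNbhd (S i) v → (p : Position v) → rankAt p ≡ 1 × InSᵢ (parentAt p)
    near-position (v∉S , _) (inside v∈S)            = ⊥-elim (v∉S v∈S)
    near-position _         (near (_ , _ , x∈S , _)) = refl , x∈S
    near-position nb        (far I)                 = ⊥-elim (I (inj₂ nb))

    rankAt-parent : (p : Position v) → ¬ InSᵢ v → rankᵢ (parentAt p) < rankAt p
    rankAt-parent (inside v∈S)             v∉S = ⊥-elim (v∉S v∈S)
    rankAt-parent (near (_ , _ , x∈S , _)) _   = s≤s (≤-reflexive (rankAt-inside (position _) x∈S))
    rankAt-parent (far I)                  _   =
      s≤s (≤-reflexive (proj₁ (near-position (relay-near I) (position _))))

    parentAt-outside : (p : Position v) → ¬ InSᵢ v → ¬ InSᵢ (parentAt p) →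
                       InI S v i × parentAt p ≡ relay i v
    parentAt-outside (inside v∈S)             v∉S _   = ⊥-elim (v∉S v∈S)
    parentAt-outside (near (_ , _ , x∈S , _)) _   x∉S = ⊥-elim (x∉S x∈S)
    parentAt-outside (far I)                  _   _   = I , refl

    open ParentExtension (S i) parentᵢ rankᵢ
      (λ v → parentAt-adj (position v))
      (λ v → rankAt-inside (position v))
      (λ v → rankAt-parent (position v))
      public

    parent-relay-inside : InI S v i → InSᵢ (parentᵢ (relay i v))
    parent-relay-inside I = proj₂ (near-position (relay-near I) (position _))

    ancestor-outside : v ↝ x → ¬ InSᵢ x → x ≡ v ⊎ (InI S v i × x ≡ relay i v)
    ancestor-outside done _ = inj₁ refl
    ancestor-outside {v} (up v∉S pv↝x) x∉S with T? (vs (S i) (parentᵢ v))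
    ... | yes pv∈S = ⊥-elim (¬↝-from-S pv∈S x∉S pv↝x)
    ... | no  pv∉S with parentAt-outside (position v) v∉S pv∉S | pv↝x
    ...   | I , pv≡relay | done       = inj₂ (I , pv≡relay)
    ...   | I , pv≡relay | up _ ppv↝x =
      ⊥-elim (¬↝-from-S (parent-relay-inside I) x∉S (subst (λ y → parentᵢ y ↝ _) pv≡relay ppv↝x))

    root-path-vertex : ∀ {r P} → InSᵢ r → Path extension r v P → x ∈ P →
                       InSᵢ x ⊎ x ≡ v ⊎ (InI S v i × x ≡ relay i v)
    root-path-vertex {x = x} r∈S (W , U) x∈P
      with lookup (path-from-S W U r∈S) x∈P | T? (vs (S i) x)
    ... | inj₁ x∈S | _       = inj₁ x∈S
    ... | inj₂ _   | yes x∈S = inj₁ x∈S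
    ... | inj₂ v↝x | no x∉S  = inj₂ (ancestor-outside v↝x x∉S)

  independent : (r : V) → (∀ i → T (vs (S i) r)) →
                (∀ i j x → i ≢ j → T (vs (S i) x) → T (vs (S j) x) → x ≡ r) →
                Independent G r t extension
  independent r r∈S disjoint v i j i≢j P Q p q x x∈P x∈Q
    with root-path-vertex i (r∈S i) p x∈P | root-path-vertex j (r∈S j) q x∈Q
  ... | inj₂ (inj₁ x≡v)         | _                     = inj₂ x≡v
  ... | _                       | inj₂ (inj₁ x≡v)       = inj₂ x≡v
  ... | inj₁ x∈Sᵢ               | inj₁ x∈Sⱼ             = inj₁ (disjoint i j x i≢j x∈Sᵢ x∈Sⱼ)
  ... | inj₁ x∈Sᵢ               | inj₂ (inj₂ (Iⱼ , refl)) = ⊥-elim (relay-outside Iⱼ i x∈Sᵢ)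
  ... | inj₂ (inj₂ (Iᵢ , refl)) | inj₁ x∈Sⱼ             = ⊥-elim (relay-outside Iᵢ j x∈Sⱼ)
  ... | inj₂ (inj₂ (Iᵢ , refl)) | inj₂ (inj₂ (Iⱼ , x≡u)) = ⊥-elim (relay-injective Iᵢ Iⱼ i≢j x≡u)

lemma3p1 : (G : Graph) (r : Fin (n G)) (t : ℕ) → t ≥ 2 →
    (S : Fin t → Subgraph G) → IsTreeCollection G r t S → Nice G t S →
    ∃[ Ts ] ((∀ i → IsTree (Ts i) × Spanning (Ts i))
           × Independent G r t Ts
           × (∀ i → S i ⊆ᴳ Ts i))
lemma3p1 G r t _ S (trees , r∈S , disjoint) nice =
  extension ,
  (λ i → extension-isTree i (trees i) , λ _ → tt) ,
  independent r r∈S disjoint ,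
  S⊆extension
  where open NiceExtension S nice
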